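{- Any sequential component with interface $(N,I,O)$ is distributed, i.e. its net $N$ is a distributed net.
   Context: Petri net $N=(S,T,F,M_0,\ell)$; ${}^\bullet x(y)=F(y,x)$, $x^\bullet(y)=F(x,y)$; $M[G\rangle M'$ iff ${}^\bullet G\le M$, $M'=M-{}^\bullet G+G^\bullet$; $t\smile u$ iff $M[\{t\}+\{u\}\rangle$ for some reachable marking $M$. A component with interface is $(N,I,O)$ with $I,O\subseteq S$, $I\cap O=\emptyset$, $o^\bullet=\emptyset$ for $o\in O$; it is sequential iff there is $Q\subseteq S\setminus(I\cup O)$ with $\sum_{q\in Q}F(q,t)=1=\sum_{q\in Q}F(t,q)$ for every $t\in T$ and $\sum_{q\in Q}M_0(q)=1$. $N$ is distributed iff there is $D:S\cup T\to\mathrm{Loc}$ with (1) $s\in{}^\bullet t\Rightarrow D(s)=D(t)$ and (2) $t\smile u\Rightarrow D(t)\ne D(u)$. -}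

module Defs where

open import Data.Nat using (ℕ; _+_; _*_; _∸_; _≤_)
open import Data.Fin using (Fin)
open import Data.Bool using (Bool; true; false)
open import Data.List using (List; map; allFin)
open import Data.Nat.ListAction using (sum)
open import Data.Fin using (_≟_)
open import Relation.Nullary using (yes; no)
open import Data.Sum using (_⊎_; inj₁; inj₂)
open import Data.Product using (Σ; _×_; _,_)
open import Relation.Binary.PropositionalEquality using (_≡_)
open import Relation.Nullary using (¬_)

Σfin : (n : ℕ) → (Fin n → ℕ) → ℕ
Σfin n f = sum (map f (allFin n))

-- A (finite) labelled Petri net with places Fin nS and transitions Fin nT.
-- The flow multiplicity F is split in its two meaningful parts:
--   pre  s t = F(s,t)   and   post t s = F(t,s).
record Net (Act : Set) : Set where
  field
    nS   : ℕ
    nT   : ℕ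
    pre  : Fin nS → Fin nT → ℕ
    post : Fin nT → Fin nS → ℕ
    M₀   : Fin nS → ℕ
    ℓ    : Fin nT → Act

module _ {Act : Set} (N : Net Act) where
  open Net N

  Marking : Set
  Marking = Fin nS → ℕ

  TMulti : Set
  TMulti = Fin nT → ℕ

  preset : TMulti → Marking
  preset G s = Σfin nT (λ t → G t * pre s t)

  postset : TMulti → Marking
  postset G s = Σfin nT (λ t → G t * post t s)

  Fires : Marking → TMulti → Marking → Set
  Fires M G M' = (∀ s → preset G s ≤ M s)
               × (∀ s → M' s ≡ (M s ∸ preset G s) + postset G s)

  data Reachable : Marking → Set where
    init : Reachable M₀
    step : ∀ {M M'} (G : TMulti) → Reachable M → Fires M G M' → Reachable M'

  pair : Fin nT → Fin nT → TMulti
  pair t u x = if-eq t x + if-eq u x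
    where
    if-eq : Fin nT → Fin nT → ℕ
    if-eq a b with a ≟ b
    ... | yes _ = 1
    ... | no  _ = 0

  Concurrent : Fin nT → Fin nT → Set
  Concurrent t u = Σ Marking λ M → Σ Marking λ M' →
                     Reachable M × Fires M (pair t u) M'

  Distributed : Set₁
  Distributed = Σ Set λ Loc → Σ (Fin nS ⊎ Fin nT → Loc) λ D →
      (∀ (s : Fin nS) (t : Fin nT) → ¬ (pre s t ≡ 0) → D (inj₁ s) ≡ D (inj₂ t))
    × (∀ (t u : Fin nT) → Concurrent t u → ¬ (D (inj₂ t) ≡ D (inj₂ u)))

  -- interface subsets given as characteristic functions on places
  Component : (I O : Fin nS → Bool) → Set
  Component I O =
      (∀ s → ¬ (I s ≡ true × O s ≡ true))
    × (∀ s → O s ≡ true → ∀ t → pre s t ≡ 0)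

  ind : (Fin nS → Bool) → Fin nS → ℕ → ℕ
  ind Q s k with Q s
  ... | true  = k
  ... | false = 0

  Sequential : (I O : Fin nS → Bool) → Set
  Sequential I O = Σ (Fin nS → Bool) λ Q →
      (∀ s → Q s ≡ true → I s ≡ false × O s ≡ false)
    × (∀ t → Σfin nS (λ q → ind Q q (pre q t)) ≡ 1
           × Σfin nS (λ q → ind Q q (post t q)) ≡ 1)
    × Σfin nS (λ q → ind Q q (M₀ q)) ≡ 1

-- With Q the state-machine places of the sequential component, every transition takes one
-- token from Q and returns one, and M₀ puts one token on Q. So the Q-weighted token count is
-- a place invariant, equal to 1 at every reachable marking, while firing a multiset G of
-- transitions needs |G| tokens on Q at once. Hence no step {t} + {u} is ever enabled: no two
-- transitions are concurrent, and a single location satisfies both distribution conditions.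
module Submission where

open import Defs
open import Data.Bool using (Bool; true; false)
open import Data.Fin using (Fin; zero; suc; _≟_)
open import Data.List using (map; allFin)
open import Data.List.Properties using (map-tabulate)
open import Data.Nat using (ℕ; _+_; _*_; _∸_; _≤_; z≤n; s≤s)
import Data.Nat.ListAction as List
open import Data.Nat.Properties
  using (module ≤-Reasoning; +-*-semiring; +-commutativeSemigroup; *-commutativeSemigroup;
         +-cancelʳ-≡; +-mono-≤; *-monoʳ-≤; *-identityʳ; *-distribˡ-+; +-identityʳ; m∸n+n≡m)
open import Data.Product using (_×_; _,_; proj₁; proj₂)
open import Data.Unit using (⊤; tt)
open import Function using (id; _∘_)
open import Relation.Nullary using (yes; no; ¬_)
open import Relation.Binary.PropositionalEquality
open import Algebra.Properties.Semiring.Sum +-*-semiring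
  using (sum; sum-cong-≗; sum-replicate-zero; ∑-distrib-+; ∑-comm; *-distribˡ-sum)
open import Algebra.Properties.CommutativeSemigroup +-commutativeSemigroup
  using (xy∙z≈xz∙y)
open import Algebra.Properties.CommutativeSemigroup *-commutativeSemigroup
  using (x∙yz≈y∙xz)

Σfin≡sum : ∀ n (f : Fin n → ℕ) → Σfin n f ≡ sum f
Σfin≡sum ℕ.zero    f = refl
Σfin≡sum (ℕ.suc n) f = cong (f zero +_) (trans
  (cong List.sum (trans (map-tabulate suc f) (sym (map-tabulate id (f ∘ suc)))))
  (Σfin≡sum n (f ∘ suc)))

sum-mono-≤ : ∀ {n} {f g : Fin n → ℕ} → (∀ i → f i ≤ g i) → sum f ≤ sum g
sum-mono-≤ {ℕ.zero}  f≤g = z≤n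
sum-mono-≤ {ℕ.suc n} f≤g = +-mono-≤ (f≤g zero) (sum-mono-≤ (f≤g ∘ suc))

δ : ∀ {n} → Fin n → Fin n → ℕ
δ a b with a ≟ b
... | yes _ = 1
... | no  _ = 0

δ-suc : ∀ {n} (a b : Fin n) → δ (suc a) (suc b) ≡ δ a b
δ-suc a b with a ≟ b
... | yes _ = refl
... | no  _ = refl

sum-δ : ∀ {n} (a : Fin n) → sum (δ a) ≡ 1
sum-δ {ℕ.suc n} zero    = cong ℕ.suc (sum-replicate-zero n)
sum-δ {ℕ.suc n} (suc a) = trans (sum-cong-≗ (δ-suc a)) (sum-δ a)

weighted : ∀ {n} → (Fin n → ℕ) → (Fin n → ℕ) → ℕ
weighted w M = sum (λ s → w s * M s)

weighted-+ : ∀ {n} (w M M′ : Fin n → ℕ) →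
             weighted w (λ s → M s + M′ s) ≡ weighted w M + weighted w M′
weighted-+ w M M′ = trans (sum-cong-≗ (λ s → *-distribˡ-+ (w s) (M s) (M′ s)))
                          (∑-distrib-+ (λ s → w s * M s) (λ s → w s * M′ s))

weighted-Σfin : ∀ {m n} (w : Fin n → ℕ) (G : Fin m → ℕ) (A : Fin n → Fin m → ℕ) →
                weighted w (λ s → Σfin m (λ t → G t * A s t))
                  ≡ sum (λ t → G t * weighted w (λ s → A s t))
weighted-Σfin {m} w G A = begin
  sum (λ s → w s * Σfin m (λ t → G t * A s t))    ≡⟨ sum-cong-≗ (λ s → cong (w s *_) (Σfin≡sum m (λ t → G t * A s t))) ⟩
  sum (λ s → w s * sum (λ t → G t * A s t))       ≡⟨ sum-cong-≗ (λ s → *-distribˡ-sum (w s) (λ t → G t * A s t)) ⟩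
  sum (λ s → sum (λ t → w s * (G t * A s t)))     ≡⟨ ∑-comm (λ s t → w s * (G t * A s t)) ⟩
  sum (λ t → sum (λ s → w s * (G t * A s t)))     ≡⟨ sum-cong-≗ (λ t → sum-cong-≗ (λ s → x∙yz≈y∙xz (w s) (G t) (A s t))) ⟩
  sum (λ t → sum (λ s → G t * (w s * A s t)))     ≡⟨ sum-cong-≗ (λ t → *-distribˡ-sum (G t) (λ s → w s * A s t)) ⟨
  sum (λ t → G t * weighted w (λ s → A s t))      ∎
  where open ≡-Reasoning

module _ {Act : Set} (N : Net Act) where
  open Net N

  pair≗δ+δ : ∀ t u x → pair N t u x ≡ δ t x + δ u x
  pair≗δ+δ t u x with t ≟ x | u ≟ x
  ... | yes _ | yes _ = refl
  ... | yes _ | no  _ = refl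
  ... | no  _ | yes _ = refl
  ... | no  _ | no  _ = refl

  sum-pair : ∀ t u → sum (pair N t u) ≡ 2
  sum-pair t u = begin
    sum (pair N t u)                ≡⟨ sum-cong-≗ (pair≗δ+δ t u) ⟩
    sum (λ x → δ t x + δ u x)       ≡⟨ ∑-distrib-+ (δ t) (δ u) ⟩
    sum (δ t) + sum (δ u)           ≡⟨ cong₂ _+_ (sum-δ t) (sum-δ u) ⟩
    2                               ∎
    where open ≡-Reasoning

  fires-balance : ∀ {M M′ G} → Fires N M G M′ → ∀ s → M′ s + preset N G s ≡ M s + postset N G s
  fires-balance {M} {M′} {G} (•G≤M , M′≡) s = begin
    M′ s + •G                 ≡⟨ cong (_+ •G) (M′≡ s) ⟩
    M s ∸ •G + G• + •G        ≡⟨ xy∙z≈xz∙y (M s ∸ •G) G• •G ⟩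
    M s ∸ •G + •G + G•        ≡⟨ cong (_+ G•) (m∸n+n≡m (•G≤M s)) ⟩
    M s + G•                  ∎
    where
    open ≡-Reasoning
    •G = preset N G s
    G• = postset N G s

  module _ (w : Fin nS → ℕ) where

    IsPlaceInvariant : Set
    IsPlaceInvariant = ∀ t → weighted w (λ s → pre s t) ≡ weighted w (post t)

    weighted-preset : ∀ G → weighted w (preset N G) ≡ sum (λ t → G t * weighted w (λ s → pre s t))
    weighted-preset G = weighted-Σfin w G pre

    weighted-postset : ∀ G → weighted w (postset N G) ≡ sum (λ t → G t * weighted w (post t))
    weighted-postset G = weighted-Σfin w G (λ s t → post t s)

    fires-preserves-weighted : IsPlaceInvariant → ∀ {M M′ G} → Fires N M G M′ →
                               weighted w M′ ≡ weighted w M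
    fires-preserves-weighted inv {M} {M′} {G} M[G⟩M′ =
      +-cancelʳ-≡ (weighted w (preset N G)) (weighted w M′) (weighted w M) (begin
        weighted w M′ + weighted w (preset N G)       ≡⟨ weighted-+ w M′ (preset N G) ⟨
        weighted w (λ s → M′ s + preset N G s)        ≡⟨ sum-cong-≗ (λ s → cong (w s *_) (fires-balance {G = G} M[G⟩M′ s)) ⟩
        weighted w (λ s → M s + postset N G s)        ≡⟨ weighted-+ w M (postset N G) ⟩
        weighted w M + weighted w (postset N G)       ≡⟨ cong (weighted w M +_) •G≡G• ⟨
        weighted w M + weighted w (preset N G)        ∎)
      where
      open ≡-Reasoning
      •G≡G• : weighted w (preset N G) ≡ weighted w (postset N G)
      •G≡G• = trans (weighted-preset G)
        (trans (sum-cong-≗ (λ t → cong (G t *_) (inv t))) (sym (weighted-postset G)))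

    reachable-weighted : IsPlaceInvariant → ∀ {M} → Reachable N M → weighted w M ≡ weighted w M₀
    reachable-weighted inv init            = refl
    reachable-weighted inv (step G r M[G⟩) =
      trans (fires-preserves-weighted inv {G = G} M[G⟩) (reachable-weighted inv r)

    IsStateMachine : Set
    IsStateMachine = ∀ t → weighted w (λ s → pre s t) ≡ 1 × weighted w (post t) ≡ 1

    state-machine-invariant : IsStateMachine → IsPlaceInvariant
    state-machine-invariant sm t = trans (proj₁ (sm t)) (sym (proj₂ (sm t)))

    fires-sum-≤ : IsStateMachine → ∀ {M M′ G} → Fires N M G M′ → sum G ≤ weighted w M
    fires-sum-≤ sm {M} {G = G} (•G≤M , _) = begin
      sum G                                           ≡⟨ sum-cong-≗ (λ t → *-identityʳ (G t)) ⟨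
      sum (λ t → G t * 1)                             ≡⟨ sum-cong-≗ (λ t → cong (G t *_) (proj₁ (sm t))) ⟨
      sum (λ t → G t * weighted w (λ s → pre s t))    ≡⟨ weighted-preset G ⟨
      weighted w (preset N G)                         ≤⟨ sum-mono-≤ (λ s → *-monoʳ-≤ (w s) (•G≤M s)) ⟩
      weighted w M                                    ∎
      where open ≤-Reasoning

    state-machine-not-concurrent : IsStateMachine → weighted w M₀ ≡ 1 →
                                   ∀ t u → ¬ Concurrent N t u
    state-machine-not-concurrent sm w₀≡1 t u (M , _ , r , M[tu⟩) = 2≰1 (begin
      2                    ≡⟨ sum-pair t u ⟨
      sum (pair N t u)     ≤⟨ fires-sum-≤ sm M[tu⟩ ⟩
      weighted w M         ≡⟨ reachable-weighted (state-machine-invariant sm) r ⟩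
      weighted w M₀        ≡⟨ w₀≡1 ⟩
      1                    ∎)
      where
      open ≤-Reasoning
      2≰1 : ¬ 2 ≤ 1
      2≰1 (s≤s ())

  module _ (Q : Fin nS → Bool) where

    indicator : Fin nS → ℕ
    indicator q = ind N Q q 1

    ind≡indicator* : ∀ q k → ind N Q q k ≡ indicator q * k
    ind≡indicator* q k with Q q
    ... | true  = sym (+-identityʳ k)
    ... | false = refl

    Σfin-ind≡weighted : ∀ M → Σfin nS (λ q → ind N Q q (M q)) ≡ weighted indicator M
    Σfin-ind≡weighted M = trans (Σfin≡sum nS (λ q → ind N Q q (M q)))
                                (sum-cong-≗ (λ q → ind≡indicator* q (M q)))

lemma4p11 : {Act : Set} (N : Net Act) (I O : Fin (Net.nS N) → Bool) →
    Component N I O → Sequential N I O → Distributed N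
lemma4p11 N I O _ (Q , _ , Q-flow , Q-M₀) =
  ⊤ , (λ _ → tt) , (λ _ _ _ → refl) ,
  λ t u t⌣u _ → state-machine-not-concurrent N (indicator N Q) Q-state-machine Q-initial t u t⌣u
  where
  open Net N
  Q-state-machine : IsStateMachine N (indicator N Q)
  Q-state-machine t =
      trans (sym (Σfin-ind≡weighted N Q (λ s → pre s t))) (proj₁ (Q-flow t))
    , trans (sym (Σfin-ind≡weighted N Q (post t))) (proj₂ (Q-flow t))
  Q-initial : weighted (indicator N Q) M₀ ≡ 1
  Q-initial = trans (sym (Σfin-ind≡weighted N Q M₀)) Q-M₀
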